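{- Let $R$ be an EPRF-TRS over a ranked alphabet $\Sigma$. Then it is decidable whether $R$ is locally confluent.
   Context: A ranked alphabet $\Sigma$ is a finite set of symbols with ranks; $X=\{x_1,x_2,\dots\}$ is a countable set of variables, $T_\Sigma(X)$ the terms over $\Sigma$ and $X$, $T_\Sigma$ the ground terms. A TRS $R$ over $\Sigma$ is a finite set of rules $l\to r$, $l,r\in T_\Sigma(X)$, with every variable of $r$ occurring in $l$; $\Rightarrow_R$ is the rewrite relation on $T_\Sigma(X)$, $\Rightarrow^*_R$ its reflexive transitive closure; $sign(R)$ is the set of symbols occurring in the rules. $R$ is locally confluent if whenever $t\Rightarrow_R t_1$ and $t\Rightarrow_R t_2$ there is $t'$ with $t_1\Rightarrow^*_R t'$ and $t_2\Rightarrow^*_R t'$. For $L\subseteq T_\Sigma$, $R^*_\Sigma(L)=\{p\mid q\Rightarrow^*_R p,\ q\in L\}$. A bottom-up tree automaton (bta) over $\Sigma$ is a finite automaton with states (treated as constants), final states, rules $\delta(a_1,\dots,a_n)\to a$ and $a\to a'$; it recognizes the ground terms rewriting to a final state. $R$ is an EPRF-TRS if for any given ranked alphabet $\Sigma\supseteq sign(R)$ and finite $L\subseteq T_\Sigma$ one can effectively construct a bta $\mathcal{C}$ over $\Sigma$ with $L(\mathcal{C})=R^*_\Sigma(L)$. -}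

module Defs where

open import Data.Nat using (ℕ)
open import Data.Fin using (Fin)
open import Data.Product using (Σ; ∃; _×_; _,_; proj₂)
open import Data.List using (List; map)
open import Data.List.Membership.Propositional using (_∈_; _∉_)
open import Data.List.Relation.Unary.All as LAll using ()
open import Data.Vec using (Vec; []; _∷_; lookup; _[_]≔_)
import Data.Vec as Vec
open import Data.Vec.Relation.Unary.All as VAll using ()
open import Data.Vec.Relation.Unary.Any as VAny using ()
open import Relation.Binary.Construct.Closure.ReflexiveTransitive using (Star)
open import Relation.Binary.PropositionalEquality using (_≡_)
open import Function.Bundles using (_⇔_)

-- A ranked symbol: (name , rank).  A ranked alphabet is a finite set
-- (list) of ranked symbols.
Sym : Set
Sym = ℕ × ℕ

arity : Sym → ℕ
arity = proj₂

Alphabet : Set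
Alphabet = List Sym

data Term : Set where
  var : ℕ → Term
  fun : (f : Sym) → Vec Term (arity f) → Term

data Over (A : Alphabet) : Term → Set where
  var : ∀ {x} → Over A (var x)
  fun : ∀ {f ts} → f ∈ A → VAll.All (Over A) ts → Over A (fun f ts)

data Ground (A : Alphabet) : Term → Set where
  fun : ∀ {f ts} → f ∈ A → VAll.All (Ground A) ts → Ground A (fun f ts)

data Occurs (x : ℕ) : Term → Set where
  here  : Occurs x (var x)
  under : ∀ {f ts} → VAny.Any (Occurs x) ts → Occurs x (fun f ts)

mutual
  _⟨_⟩ : Term → (ℕ → Term) → Term
  var x ⟨ σ ⟩ = σ x
  fun f ts ⟨ σ ⟩ = fun f (substs ts σ)

  substs : ∀ {n} → Vec Term n → (ℕ → Term) → Vec Term n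
  substs [] σ = []
  substs (t ∷ ts) σ = (t ⟨ σ ⟩) ∷ substs ts σ

Rule : Set
Rule = Term × Term

data Step (Rs : List Rule) : Term → Term → Set where
  root : ∀ {l r} → (l , r) ∈ Rs → (σ : ℕ → Term) → Step Rs (l ⟨ σ ⟩) (r ⟨ σ ⟩)
  arg  : ∀ {f ts u} (i : Fin (arity f)) → Step Rs (lookup ts i) u →
         Step Rs (fun f ts) (fun f (ts [ i ]≔ u))

Steps : List Rule → Term → Term → Set
Steps Rs = Star (Step Rs)

record TRS : Set where
  field
    alphabet : Alphabet
    rules    : List Rule
    rulesOver : LAll.All (λ lr → Over alphabet (Data.Product.proj₁ lr) × Over alphabet (proj₂ lr)) rules
    varCond  : LAll.All (λ lr → ∀ x → Occurs x (proj₂ lr) → Occurs x (Data.Product.proj₁ lr)) rules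
open TRS public

SignIn : TRS → Alphabet → Set
SignIn R A = LAll.All (λ lr → Over A (Data.Product.proj₁ lr) × Over A (proj₂ lr)) (rules R)

LocallyConfluent : TRS → Set
LocallyConfluent R = ∀ t t₁ t₂ → Over (alphabet R) t →
  Step (rules R) t t₁ → Step (rules R) t t₂ →
  ∃ λ t' → Steps (rules R) t₁ t' × Steps (rules R) t₂ t'

Descendant : TRS → List Term → Term → Set
Descendant R L p = ∃ λ q → q ∈ L × Steps (rules R) q p

-- Bottom-up tree automata.  States are new constants: a state named a is
-- the rank-0 symbol (a , 0), required not to belong to Σ.
stateTerm : ℕ → Term
stateTerm a = fun (a , 0) []

data BRule : Set where
  move : (δ : Sym) → Vec ℕ (arity δ) → ℕ → BRule
  eps  : ℕ → ℕ → BRule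

WFBRule : Alphabet → List ℕ → BRule → Set
WFBRule A Q (move δ as a) = δ ∈ A × VAll.All (_∈ Q) as × a ∈ Q
WFBRule A Q (eps a a')    = a ∈ Q × a' ∈ Q

bruleTerms : BRule → Rule
bruleTerms (move δ as a) = fun δ (Vec.map stateTerm as) , stateTerm a
bruleTerms (eps a a')    = stateTerm a , stateTerm a'

record BTA (A : Alphabet) : Set where
  field
    states  : List ℕ
    fresh   : LAll.All (λ a → (a , 0) ∉ A) states
    final   : List ℕ
    finalOK : LAll.All (_∈ states) final
    brules  : List BRule
    brulesOK : LAll.All (WFBRule A states) brules

Accepts : ∀ {A} → BTA A → Term → Set
Accepts {A} C t = Ground A t ×
  ∃ λ q → q ∈ BTA.final C × Steps (map bruleTerms (BTA.brules C)) t (stateTerm q)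

EPRF : TRS → Set
EPRF R = (A : Alphabet) → SignIn R A → (L : List Term) → LAll.All (Ground A) L →
  Σ (BTA A) λ C → ∀ t → Accepts C t ⇔ Descendant R L t

module Submission where

-- Critical pair lemma: R is locally confluent iff for all rules l₁ → r₁,
-- l₂ → r₂ and positions p of l₁ at which l₁|ₚ unifies with a renamed copy
-- l₂' of l₂, with most general unifier θ, the pair r₁θ , (l₁[r₂']ₚ)θ is
-- joinable.  These finitely many pairs are computed by syntactic unification,
-- so it remains to decide joinability of two terms s, t.  Freezing their
-- variables into fresh constants, the EPRF property gives tree automata for
-- the descendants of the frozen s and t; s, t are joinable iff the two
-- languages intersect, which is decided by saturating a Horn clause system
-- over pairs of states.

open import Defs
open import Data.Empty using (⊥; ⊥-elim)
open import Data.Unit using (⊤; tt)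
open import Data.Nat as ℕ using (ℕ; zero; suc; _+_; _∸_; _≤_; _<_; s≤s)
import Data.Nat.Properties as ℕₚ
open import Data.Nat.ListAction using (sum)
open import Data.Nat.ListAction.Properties using (sum-++)
open import Algebra.Properties.CommutativeSemigroup ℕₚ.+-commutativeSemigroup
  using () renaming (interchange to +-interchange)
open import Data.Fin as Fin using (Fin; zero; suc)
open import Data.Product using (Σ; ∃; _×_; _,_; proj₁; proj₂)
open import Data.Product.Properties using (≡-dec)
open import Data.Sum using (_⊎_; inj₁; inj₂)
open import Data.List as List using (List; []; _∷_; map; _++_; length; concatMap)
import Data.List.Properties as Listₚ
open import Data.List.Membership.Propositional using (_∈_; _∉_; find; lose)
open import Data.List.Membership.Propositional.Properties
  using (∈-map⁺; ∈-map⁻; ∈-++⁺ˡ; ∈-++⁺ʳ; ∈-filter⁺; ∈-concatMap⁺)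
open import Data.List.Relation.Unary.Any as Any using (here; there)
open import Data.List.Relation.Binary.Permutation.Propositional as Perm using (_↭_; ↭-sym)
open import Data.List.Relation.Binary.Permutation.Propositional.Properties using (↭-length; ∈-resp-↭)
import Data.List.Relation.Unary.All as LAll
import Data.List.Relation.Unary.All.Properties as LAllₚ
open import Data.Vec as Vec using (Vec; []; _∷_; lookup; _[_]≔_)
open import Data.Vec.Properties
  using ([]≔-lookup; lookup∘update; lookup∘update′; []≔-idempotent; []≔-commutes; ∷-injective; lookup∘tabulate; lookup-map)
import Data.Vec.Relation.Unary.All as VAll
import Data.Vec.Relation.Unary.All.Properties as VAllₚ
import Data.Vec.Relation.Unary.Any as VAny
open import Data.Vec.Relation.Binary.Pointwise.Inductive as Pointwise using (Pointwise)
import Data.Vec.Relation.Binary.Pointwise.Extensional as Pointwiseₑ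
open import Relation.Binary.Construct.Closure.ReflexiveTransitive using (Star; ε; _◅_; _◅◅_; gmap)
open import Relation.Binary.PropositionalEquality
open import Relation.Binary.Definitions using (DecidableEquality)
open import Relation.Nullary using (Dec; yes; no; ¬_; ¬?)
import Relation.Nullary.Decidable as Dec
open import Function.Base using (_∘_)
open import Function.Bundles using (_⇔_; mk⇔; Equivalence)

Subst : Set
Subst = ℕ → Term

_⨾_ : Subst → Subst → Subst
(σ ⨾ τ) x = σ x ⟨ τ ⟩

mutual
  subst-comp : ∀ t σ τ → t ⟨ σ ⟩ ⟨ τ ⟩ ≡ t ⟨ σ ⨾ τ ⟩
  subst-comp (var x) σ τ = refl
  subst-comp (fun f ts) σ τ = cong (fun f) (substs-comp ts σ τ)

  substs-comp : ∀ {n} (ts : Vec Term n) σ τ → substs (substs ts σ) τ ≡ substs ts (σ ⨾ τ)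
  substs-comp [] σ τ = refl
  substs-comp (t ∷ ts) σ τ = cong₂ _∷_ (subst-comp t σ τ) (substs-comp ts σ τ)

mutual
  subst-ext : ∀ t {σ σ'} → (∀ x → Occurs x t → σ x ≡ σ' x) → t ⟨ σ ⟩ ≡ t ⟨ σ' ⟩
  subst-ext (var x) h = h x here
  subst-ext (fun f ts) h = cong (fun f) (substs-ext ts (λ x o → h x (under o)))

  substs-ext : ∀ {n} (ts : Vec Term n) {σ σ'} →
               (∀ x → VAny.Any (Occurs x) ts → σ x ≡ σ' x) → substs ts σ ≡ substs ts σ'
  substs-ext [] h = refl
  substs-ext (t ∷ ts) h =
    cong₂ _∷_ (subst-ext t (λ x o → h x (VAny.here o))) (substs-ext ts (λ x o → h x (VAny.there o)))

subst-cong : ∀ t {σ σ'} → (∀ x → σ x ≡ σ' x) → t ⟨ σ ⟩ ≡ t ⟨ σ' ⟩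
subst-cong t h = subst-ext t (λ x _ → h x)

mutual
  subst-id : ∀ t → t ⟨ var ⟩ ≡ t
  subst-id (var x) = refl
  subst-id (fun f ts) = cong (fun f) (substs-id ts)

  substs-id : ∀ {n} (ts : Vec Term n) → substs ts var ≡ ts
  substs-id [] = refl
  substs-id (t ∷ ts) = cong₂ _∷_ (subst-id t) (substs-id ts)

lookup-substs : ∀ {n} (ts : Vec Term n) i σ → lookup (substs ts σ) i ≡ lookup ts i ⟨ σ ⟩
lookup-substs (t ∷ ts) zero σ = refl
lookup-substs (t ∷ ts) (suc i) σ = lookup-substs ts i σ

substs-update : ∀ {n} (ts : Vec Term n) i u σ → substs (ts [ i ]≔ u) σ ≡ substs ts σ [ i ]≔ (u ⟨ σ ⟩)
substs-update (t ∷ ts) zero u σ = refl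
substs-update (t ∷ ts) (suc i) u σ = cong (_ ∷_) (substs-update ts i u σ)

any-lookup : ∀ {n} {P : Term → Set} (ts : Vec Term n) i → P (lookup ts i) → VAny.Any P ts
any-lookup (t ∷ ts) zero p = VAny.here p
any-lookup (t ∷ ts) (suc i) p = VAny.there (any-lookup ts i p)

mutual
  occurs-subst : ∀ {y} t σ → Occurs y (t ⟨ σ ⟩) → ∃ λ x → Occurs x t × Occurs y (σ x)
  occurs-subst (var x) σ o = x , here , o
  occurs-subst (fun f ts) σ (under o) with occurss-subst ts σ o
  ... | x , a , b = x , under a , b

  occurss-subst : ∀ {y n} (ts : Vec Term n) σ → VAny.Any (Occurs y) (substs ts σ) →
                  ∃ λ x → VAny.Any (Occurs x) ts × Occurs y (σ x)
  occurss-subst (t ∷ ts) σ (VAny.here o) with occurs-subst t σ o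
  ... | x , a , b = x , VAny.here a , b
  occurss-subst (t ∷ ts) σ (VAny.there o) with occurss-subst ts σ o
  ... | x , a , b = x , VAny.there a , b

mutual
  occurs? : ∀ x t → Dec (Occurs x t)
  occurs? x (var y) with x ℕ.≟ y
  ... | yes refl = yes here
  ... | no x≢y = no λ { here → x≢y refl }
  occurs? x (fun f ts) with occurss? x ts
  ... | yes o = yes (under o)
  ... | no ¬o = no λ { (under o) → ¬o o }

  occurss? : ∀ x {n} (ts : Vec Term n) → Dec (VAny.Any (Occurs x) ts)
  occurss? x [] = no λ ()
  occurss? x (t ∷ ts) with occurs? x t | occurss? x ts
  ... | yes o | _ = yes (VAny.here o)
  ... | no _ | yes o = yes (VAny.there o)
  ... | no ¬o | no ¬os = no λ { (VAny.here o) → ¬o o ; (VAny.there o) → ¬os o }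

mutual
  over-subst : ∀ {A} t σ → Over A t → (∀ x → Over A (σ x)) → Over A (t ⟨ σ ⟩)
  over-subst (var x) σ o h = h x
  over-subst (fun f ts) σ (fun m os) h = fun m (overs-subst ts σ os h)

  overs-subst : ∀ {A n} (ts : Vec Term n) σ → VAll.All (Over A) ts → (∀ x → Over A (σ x)) →
                VAll.All (Over A) (substs ts σ)
  overs-subst [] σ VAll.[] h = VAll.[]
  overs-subst (t ∷ ts) σ (o VAll.∷ os) h = over-subst t σ o h VAll.∷ overs-subst ts σ os h

mutual
  over-mono : ∀ {A A'} → (∀ {f} → f ∈ A → f ∈ A') → ∀ {t} → Over A t → Over A' t
  over-mono h var = var
  over-mono h (fun m os) = fun (h m) (overs-mono h os)

  overs-mono : ∀ {A A'} → (∀ {f} → f ∈ A → f ∈ A') → ∀ {n} {ts : Vec Term n} →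
               VAll.All (Over A) ts → VAll.All (Over A') ts
  overs-mono h VAll.[] = VAll.[]
  overs-mono h (o VAll.∷ os) = over-mono h o VAll.∷ overs-mono h os

head-injective : ∀ {f g} {ts : Vec Term (arity f)} {us : Vec Term (arity g)} → fun f ts ≡ fun g us → f ≡ g
head-injective refl = refl

args-injective : ∀ {f} {ts us : Vec Term (arity f)} → fun f ts ≡ fun f us → ts ≡ us
args-injective refl = refl

module _ {Rs : List Rule} where

  Joinable : Term → Term → Set
  Joinable a b = ∃ λ c → Steps Rs a c × Steps Rs b c

  join-sym : ∀ {a b} → Joinable a b → Joinable b a
  join-sym (c , p , q) = c , q , p

  step-subst : ∀ {s t} τ → Step Rs s t → Step Rs (s ⟨ τ ⟩) (t ⟨ τ ⟩)
  step-subst τ (root {l} {r} m σ) rewrite subst-comp l σ τ | subst-comp r σ τ = root m (σ ⨾ τ)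
  step-subst τ (arg {f} {ts} {u} i s) rewrite substs-update ts i u τ =
    arg i (subst (λ z → Step Rs z (u ⟨ τ ⟩)) (sym (lookup-substs ts i τ)) (step-subst τ s))

  steps-subst : ∀ {s t} τ → Steps Rs s t → Steps Rs (s ⟨ τ ⟩) (t ⟨ τ ⟩)
  steps-subst τ = gmap (_⟨ τ ⟩) (step-subst τ)

  join-subst : ∀ {a b} τ → Joinable a b → Joinable (a ⟨ τ ⟩) (b ⟨ τ ⟩)
  join-subst τ (c , p , q) = c ⟨ τ ⟩ , steps-subst τ p , steps-subst τ q

  step-at : ∀ {f} (ts : Vec Term (arity f)) i {a b} → Step Rs a b →
            Step Rs (fun f (ts [ i ]≔ a)) (fun f (ts [ i ]≔ b))
  step-at {f} ts i {a} s =
    subst (λ us → Step Rs (fun f (ts [ i ]≔ a)) (fun f us)) ([]≔-idempotent ts i)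
      (arg i (subst (λ z → Step Rs z _) (sym (lookup∘update i ts a)) s))

  steps-at : ∀ {f} (ts : Vec Term (arity f)) i {a b} → Steps Rs a b →
             Steps Rs (fun f (ts [ i ]≔ a)) (fun f (ts [ i ]≔ b))
  steps-at {f} ts i = gmap (λ u → fun f (ts [ i ]≔ u)) (step-at ts i)

  steps-args : ∀ {n} (K : Vec Term n → Term) →
               (∀ {ts} i {b} → Step Rs (lookup ts i) b → Step Rs (K ts) (K (ts [ i ]≔ b))) →
               ∀ {ts us} → Pointwise (Steps Rs) ts us → Steps Rs (K ts) (K us)
  steps-args K step Pointwise.[] = ε
  steps-args K step {t ∷ ts} {u ∷ us} (p Pointwise.∷ ps) =
    gmap (λ z → K (z ∷ ts)) (step zero) p ◅◅ steps-args (λ vs → K (u ∷ vs)) (λ i → step (suc i)) ps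

  steps-fun : ∀ {f} {ts us : Vec Term (arity f)} → Pointwise (Steps Rs) ts us → Steps Rs (fun f ts) (fun f us)
  steps-fun {f} = steps-args (fun f) (λ i s → arg i s)

  mutual
    steps-substs : ∀ t {σ σ'} → (∀ y → Steps Rs (σ y) (σ' y)) → Steps Rs (t ⟨ σ ⟩) (t ⟨ σ' ⟩)
    steps-substs (var x) h = h x
    steps-substs (fun f ts) h = steps-fun (steps-substsᵛ ts h)

    steps-substsᵛ : ∀ {n} (ts : Vec Term n) {σ σ'} → (∀ y → Steps Rs (σ y) (σ' y)) →
                    Pointwise (Steps Rs) (substs ts σ) (substs ts σ')
    steps-substsᵛ [] h = Pointwise.[]
    steps-substsᵛ (t ∷ ts) h = steps-substs t h Pointwise.∷ steps-substsᵛ ts h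

data Pos : Term → Set where
  top   : ∀ {t} → Pos t
  below : ∀ {f ts} (i : Fin (arity f)) → Pos (lookup ts i) → Pos (fun f ts)

_∣_ : (t : Term) → Pos t → Term
t ∣ top = t
fun f ts ∣ below i p = lookup ts i ∣ p

_[_←_] : (t : Term) → Pos t → Term → Term
t [ top ← u ] = u
fun f ts [ below i p ← u ] = fun f (ts [ i ]≔ (lookup ts i [ p ← u ]))

-- fillⁱ L p σ u is the instance L ⟨ σ ⟩ with its subterm at p replaced by u;
-- positions of L are positions of every instance of L.
fillⁱ : (L : Term) → Pos L → Subst → Term → Term
fillⁱ L top σ u = u
fillⁱ (fun f ts) (below i p) σ u = fun f (substs ts σ [ i ]≔ fillⁱ (lookup ts i) p σ u)

fillⁱ-subterm : ∀ L p σ → fillⁱ L p σ ((L ∣ p) ⟨ σ ⟩) ≡ L ⟨ σ ⟩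
fillⁱ-subterm L top σ = refl
fillⁱ-subterm (fun f ts) (below i p) σ = cong (fun f) (begin
  substs ts σ [ i ]≔ fillⁱ (lookup ts i) p σ ((lookup ts i ∣ p) ⟨ σ ⟩)
    ≡⟨ cong (substs ts σ [ i ]≔_) (fillⁱ-subterm (lookup ts i) p σ) ⟩
  substs ts σ [ i ]≔ (lookup ts i ⟨ σ ⟩)
    ≡⟨ cong (substs ts σ [ i ]≔_) (sym (lookup-substs ts i σ)) ⟩
  substs ts σ [ i ]≔ lookup (substs ts σ) i
    ≡⟨ []≔-lookup (substs ts σ) i ⟩
  substs ts σ ∎)
  where open ≡-Reasoning

replace-subst : ∀ L p u σ → (L [ p ← u ]) ⟨ σ ⟩ ≡ fillⁱ L p σ (u ⟨ σ ⟩)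
replace-subst L top u σ = refl
replace-subst (fun f ts) (below i p) u σ =
  cong (fun f) (trans (substs-update ts i _ σ)
                      (cong (substs ts σ [ i ]≔_) (replace-subst (lookup ts i) p u σ)))

occurs-subterm : ∀ {x} L p → Occurs x (L ∣ p) → Occurs x L
occurs-subterm L top o = o
occurs-subterm (fun f ts) (below i p) o = under (any-lookup ts i (occurs-subterm (lookup ts i) p o))

fillⁱ-ext : ∀ L p {σ σ'} u → (∀ x → Occurs x L → σ x ≡ σ' x) → fillⁱ L p σ u ≡ fillⁱ L p σ' u
fillⁱ-ext L top u h = refl
fillⁱ-ext (fun f ts) (below i p) u h =
  cong (fun f) (cong₂ _[ i ]≔_ (substs-ext ts (λ x o → h x (under o)))
                               (fillⁱ-ext (lookup ts i) p u (λ x o → h x (under (any-lookup ts i o)))))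

over-subterm : ∀ {A} L p → Over A L → Over A (L ∣ p)
over-subterm L top o = o
over-subterm (fun f ts) (below i p) (fun _ os) = over-subterm (lookup ts i) p (VAllₚ.lookup⁺ os i)

over-replace : ∀ {A} L p u → Over A L → Over A u → Over A (L [ p ← u ])
over-replace L top u oL ou = ou
over-replace (fun f ts) (below i p) u (fun m os) ou =
  fun m (all-update i os (over-replace (lookup ts i) p u (VAllₚ.lookup⁺ os i) ou))
  where
  all-update : ∀ {A n} {P : A → Set} {vs : Vec A n} i {v} → VAll.All P vs → P v → VAll.All P (vs [ i ]≔ v)
  all-update zero (_ VAll.∷ ps) q = q VAll.∷ ps
  all-update (suc i) (p VAll.∷ ps) q = p VAll.∷ all-update i ps q

mutual
  positions : (t : Term) → List (Pos t)
  positions (var x) = top ∷ []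
  positions (fun f ts) = top ∷ map (λ ip → below (proj₁ ip) (proj₂ ip)) (positionsᵛ ts)

  positionsᵛ : ∀ {n} (ts : Vec Term n) → List (Σ (Fin n) λ i → Pos (lookup ts i))
  positionsᵛ [] = []
  positionsᵛ (t ∷ ts) = map (λ p → zero , p) (positions t) ++ map (λ ip → suc (proj₁ ip) , proj₂ ip) (positionsᵛ ts)

mutual
  positions-complete : ∀ t (p : Pos t) → p ∈ positions t
  positions-complete (var x) top = here refl
  positions-complete (fun f ts) top = here refl
  positions-complete (fun f ts) (below i p) = there (∈-map⁺ _ (positionsᵛ-complete ts i p))

  positionsᵛ-complete : ∀ {n} (ts : Vec Term n) i (p : Pos (lookup ts i)) → (i , p) ∈ positionsᵛ ts
  positionsᵛ-complete (t ∷ ts) zero p = ∈-++⁺ˡ (∈-map⁺ _ (positions-complete t p))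
  positionsᵛ-complete (t ∷ ts) (suc i) p = ∈-++⁺ʳ _ (∈-map⁺ _ (positionsᵛ-complete ts i p))

all-positions? : ∀ t {Q : Pos t → Set} → (∀ p → Dec (Q p)) → Dec (∀ p → Q p)
all-positions? t Q? with LAll.all? Q? (positions t)
... | yes all = yes (λ p → LAll.lookup all (positions-complete t p))
... | no ¬all = no (λ q → ¬all (LAll.tabulate (λ {p} _ → q p)))

module _ {Rs : List Rule} where

  fillⁱ-step : ∀ L p σ {a b} → Step Rs a b → Step Rs (fillⁱ L p σ a) (fillⁱ L p σ b)
  fillⁱ-step L top σ s = s
  fillⁱ-step (fun f ts) (below i p) σ s = step-at (substs ts σ) i (fillⁱ-step (lookup ts i) p σ s)

  fillⁱ-steps-subst : ∀ L p {σ σ'} u → (∀ y → Steps Rs (σ y) (σ' y)) → Steps Rs (fillⁱ L p σ u) (fillⁱ L p σ' u)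
  fillⁱ-steps-subst L top u h = ε
  fillⁱ-steps-subst (fun f ts) (below i p) u h =
    steps-fun (pointwise-update i (steps-substsᵛ ts h) (fillⁱ-steps-subst (lookup ts i) p u h))
    where
    pointwise-update : ∀ {n} {vs ws : Vec Term n} i {a b} → Pointwise (Steps Rs) vs ws → Steps Rs a b →
                       Pointwise (Steps Rs) (vs [ i ]≔ a) (ws [ i ]≔ b)
    pointwise-update zero (_ Pointwise.∷ ps) q = q Pointwise.∷ ps
    pointwise-update (suc i) (p Pointwise.∷ ps) q = p Pointwise.∷ pointwise-update i ps q

  data StepFromInstance (L : Term) (σ : Subst) (u : Term) : Set where
    inVariable : ∀ p x w → L ∣ p ≡ var x → Step Rs (σ x) w → u ≡ fillⁱ L p σ w →
                 StepFromInstance L σ u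
    ruleOverlap : ∀ p {l₂ r₂} σ₂ → (l₂ , r₂) ∈ Rs → l₂ ⟨ σ₂ ⟩ ≡ (L ∣ p) ⟨ σ ⟩ →
                  u ≡ fillⁱ L p σ (r₂ ⟨ σ₂ ⟩) → StepFromInstance L σ u

  step-from-instance : ∀ L σ {t u} → t ≡ L ⟨ σ ⟩ → Step Rs t u → StepFromInstance L σ u
  step-from-instance (var x) σ refl s = inVariable top x _ refl s refl
  step-from-instance (fun f ls) σ e (root m σ₂) = ruleOverlap top σ₂ m e refl
  step-from-instance (fun f ls) σ refl (arg i s)
    with step-from-instance (lookup ls i) σ (lookup-substs ls i σ) s
  ... | inVariable p x w e s' refl = inVariable (below i p) x w e s' refl
  ... | ruleOverlap p σ₂ m e refl = ruleOverlap (below i p) σ₂ m e refl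

Equation : Set
Equation = Term × Term

Unifies : Subst → List Equation → Set
Unifies θ E = LAll.All (λ e → proj₁ e ⟨ θ ⟩ ≡ proj₂ e ⟨ θ ⟩) E

-- θ is most general: every unifier τ factors through θ, as θ ⨾ τ = τ.
MostGeneral : Subst → List Equation → Set
MostGeneral θ E = ∀ τ → Unifies τ E → ∀ x → θ x ⟨ τ ⟩ ≡ τ x

OverEqs : Alphabet → List Equation → Set
OverEqs A E = LAll.All (λ e → Over A (proj₁ e) × Over A (proj₂ e)) E

UnifyResult : Alphabet → List Equation → Set
UnifyResult A E =
  (Σ Subst λ θ → Unifies θ E × MostGeneral θ E × (∀ x → Over A (θ x))) ⊎ (∀ τ → ¬ Unifies τ E)

mutual
  size : Term → ℕ
  size (var x) = 1
  size (fun f ts) = suc (sizes ts)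

  sizes : ∀ {n} → Vec Term n → ℕ
  sizes [] = 0
  sizes (t ∷ ts) = size t + sizes ts

eqSize : Equation → ℕ
eqSize (s , t) = size s + size t

sizeEqs : List Equation → ℕ
sizeEqs E = sum (map eqSize E)

-- Occurs check: a variable is strictly smaller than any proper term containing it.
mutual
  size-occurs : ∀ {x} t τ → Occurs x t → size (τ x) ≤ size (t ⟨ τ ⟩)
  size-occurs (var x) τ here = ℕₚ.≤-refl
  size-occurs (fun f ts) τ (under o) = ℕₚ.m≤n⇒m≤1+n (sizes-occurs ts τ o)

  sizes-occurs : ∀ {x n} (ts : Vec Term n) τ → VAny.Any (Occurs x) ts → size (τ x) ≤ sizes (substs ts τ)
  sizes-occurs (t ∷ ts) τ (VAny.here o) = ℕₚ.≤-trans (size-occurs t τ o) (ℕₚ.m≤m+n _ _)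
  sizes-occurs (t ∷ ts) τ (VAny.there o) = ℕₚ.≤-trans (sizes-occurs ts τ o) (ℕₚ.m≤n+m _ _)

occurs-check : ∀ {x f ts} τ → Occurs x (fun f ts) → τ x ≢ fun f ts ⟨ τ ⟩
occurs-check {ts = ts} τ (under o) e =
  ℕₚ.<-irrefl refl (subst (λ z → size (τ _) < size z) (sym e) (s≤s (sizes-occurs ts τ o)))

zipEqs : ∀ {n} → Vec Term n → Vec Term n → List Equation
zipEqs [] [] = []
zipEqs (a ∷ as) (b ∷ bs) = (a , b) ∷ zipEqs as bs

zipEqs-size : ∀ {n} (ss ts : Vec Term n) → sizeEqs (zipEqs ss ts) ≡ sizes ss + sizes ts
zipEqs-size [] [] = refl
zipEqs-size (a ∷ as) (b ∷ bs) =
  trans (cong (size a + size b +_) (zipEqs-size as bs)) (+-interchange (size a) (size b) (sizes as) (sizes bs))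

zipEqs-over : ∀ {A n} {ss ts : Vec Term n} → VAll.All (Over A) ss → VAll.All (Over A) ts → OverEqs A (zipEqs ss ts)
zipEqs-over VAll.[] VAll.[] = LAll.[]
zipEqs-over (p VAll.∷ ps) (q VAll.∷ qs) = (p , q) LAll.∷ zipEqs-over ps qs

zipEqs-unifies : ∀ {n} τ (ss ts : Vec Term n) → Unifies τ (zipEqs ss ts) ⇔ (substs ss τ ≡ substs ts τ)
zipEqs-unifies τ ss ts = mk⇔ (to ss ts) (from ss ts)
  where
  to : ∀ {n} (ss ts : Vec Term n) → Unifies τ (zipEqs ss ts) → substs ss τ ≡ substs ts τ
  to [] [] _ = refl
  to (a ∷ as) (b ∷ bs) (e LAll.∷ es) = cong₂ _∷_ e (to as bs es)
  from : ∀ {n} (ss ts : Vec Term n) → substs ss τ ≡ substs ts τ → Unifies τ (zipEqs ss ts)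
  from [] [] _ = LAll.[]
  from (a ∷ as) (b ∷ bs) e = proj₁ (∷-injective e) LAll.∷ from as bs (proj₂ (∷-injective e))

mutual
  vars : Term → List ℕ
  vars (var x) = x ∷ []
  vars (fun f ts) = varsᵛ ts

  varsᵛ : ∀ {n} → Vec Term n → List ℕ
  varsᵛ [] = []
  varsᵛ (t ∷ ts) = vars t ++ varsᵛ ts

mutual
  vars-complete : ∀ {y} t → Occurs y t → y ∈ vars t
  vars-complete (var x) here = here refl
  vars-complete (fun f ts) (under o) = varsᵛ-complete ts o

  varsᵛ-complete : ∀ {y n} (ts : Vec Term n) → VAny.Any (Occurs y) ts → y ∈ varsᵛ ts
  varsᵛ-complete (t ∷ ts) (VAny.here o) = ∈-++⁺ˡ (vars-complete t o)
  varsᵛ-complete (t ∷ ts) (VAny.there o) = ∈-++⁺ʳ (vars t) (varsᵛ-complete ts o)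

VarsIn : List ℕ → Equation → Set
VarsIn V e = ∀ y → Occurs y (proj₁ e) ⊎ Occurs y (proj₂ e) → y ∈ V

zipEqs-vars : ∀ V {n} (ss ts : Vec Term n) →
              (∀ y → VAny.Any (Occurs y) ss ⊎ VAny.Any (Occurs y) ts → y ∈ V) → LAll.All (VarsIn V) (zipEqs ss ts)
zipEqs-vars V [] [] h = LAll.[]
zipEqs-vars V (a ∷ as) (b ∷ bs) h =
  (λ { y (inj₁ o) → h y (inj₁ (VAny.here o)) ; y (inj₂ o) → h y (inj₂ (VAny.here o)) })
  LAll.∷ zipEqs-vars V as bs (λ { y (inj₁ o) → h y (inj₁ (VAny.there o)) ; y (inj₂ o) → h y (inj₂ (VAny.there o)) })

_↦_ : ℕ → Term → Subst
(x ↦ t) y with y ℕ.≟ x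
... | yes _ = t
... | no _ = var y

↦-cases : ∀ x t y → (y ≡ x × (x ↦ t) y ≡ t) ⊎ (y ≢ x × (x ↦ t) y ≡ var y)
↦-cases x t y with y ℕ.≟ x
... | yes e = inj₁ (e , refl)
... | no ne = inj₂ (ne , refl)

↦-self : ∀ x t → (x ↦ t) x ≡ t
↦-self x t with ↦-cases x t x
... | inj₁ (_ , e) = e
... | inj₂ (x≢x , _) = ⊥-elim (x≢x refl)

↦-fresh : ∀ x t m → ¬ Occurs x m → m ⟨ x ↦ t ⟩ ≡ m
↦-fresh x t m x∉m = trans (subst-ext m agree) (subst-id m)
  where
  agree : ∀ y → Occurs y m → (x ↦ t) y ≡ var y
  agree y o with ↦-cases x t y
  ... | inj₁ (refl , _) = ⊥-elim (x∉m o)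
  ... | inj₂ (_ , e) = e

↦-over : ∀ {A} x t → Over A t → ∀ y → Over A ((x ↦ t) y)
↦-over x t o y with ↦-cases x t y
... | inj₁ (_ , e) = subst (Over _) (sym e) o
... | inj₂ (_ , e) = subst (Over _) (sym e) var

↦-absorb : ∀ x t τ → τ x ≡ t ⟨ τ ⟩ → ∀ y → ((x ↦ t) ⨾ τ) y ≡ τ y
↦-absorb x t τ e y with ↦-cases x t y
... | inj₁ (refl , e') = trans (cong (_⟨ τ ⟩) e') (sym e)
... | inj₂ (_ , e') = cong (_⟨ τ ⟩) e'

substEq : Subst → Equation → Equation
substEq σ (s , t) = s ⟨ σ ⟩ , t ⟨ σ ⟩

unifies-substEqs : ∀ σ τ E → Unifies τ (map (substEq σ) E) ⇔ Unifies (σ ⨾ τ) E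
unifies-substEqs σ τ E = mk⇔ (to E) (from E)
  where
  to : ∀ E → Unifies τ (map (substEq σ) E) → Unifies (σ ⨾ τ) E
  to [] LAll.[] = LAll.[]
  to ((s , t) ∷ E) (e LAll.∷ es) = trans (sym (subst-comp s σ τ)) (trans e (subst-comp t σ τ)) LAll.∷ to E es
  from : ∀ E → Unifies (σ ⨾ τ) E → Unifies τ (map (substEq σ) E)
  from [] LAll.[] = LAll.[]
  from ((s , t) ∷ E) (e LAll.∷ es) = trans (subst-comp s σ τ) (trans e (sym (subst-comp t σ τ))) LAll.∷ from E es

absorbed-unifies : ∀ σ τ E → (∀ x → (σ ⨾ τ) x ≡ τ x) → Unifies τ E → Unifies τ (map (substEq σ) E)
absorbed-unifies σ τ E absorb U =
  Equivalence.from (unifies-substEqs σ τ E)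
    (LAll.map (λ {e} eq → trans (subst-cong (proj₁ e) absorb) (trans eq (sym (subst-cong (proj₂ e) absorb)))) U)

overEqs-subst : ∀ {A} σ E → (∀ x → Over A (σ x)) → OverEqs A E → OverEqs A (map (substEq σ) E)
overEqs-subst σ [] h LAll.[] = LAll.[]
overEqs-subst σ ((s , t) ∷ E) h ((p , q) LAll.∷ ps) =
  (over-subst s σ p h , over-subst t σ q h) LAll.∷ overEqs-subst σ E h ps

remove : ℕ → List ℕ → List ℕ
remove x = List.filter (λ y → ¬? (y ℕ.≟ x))

remove-shorter : ∀ {x V} → x ∈ V → length (remove x V) < length V
remove-shorter {x} {V} x∈V =
  Listₚ.filter-notAll (λ y → ¬? (y ℕ.≟ x)) V (Any.map (λ { refl y≢y → y≢y refl }) x∈V)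

↦-varsIn : ∀ V x t → ¬ Occurs x t → (∀ y → Occurs y t → y ∈ V) →
           ∀ e → VarsIn V e → VarsIn (remove x V) (substEq (x ↦ t) e)
↦-varsIn V x t x∉t t⊆V (s , u) h y o = ∈-filter⁺ (λ y → ¬? (y ℕ.≟ x)) (proj₁ (in-V o)) (proj₂ (in-V o))
  where
  origin : ∀ m → Occurs y (m ⟨ x ↦ t ⟩) → (Occurs y m ⊎ Occurs y t) × y ≢ x
  origin m o' with occurs-subst m (x ↦ t) o'
  ... | z , oz , oy with ↦-cases x t z
  ...   | inj₁ (refl , e) = inj₂ (subst (Occurs y) e oy) , λ { refl → x∉t (subst (Occurs y) e oy) }
  ...   | inj₂ (z≢x , e) with subst (Occurs y) e oy
  ...     | here = inj₁ oz , z≢x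
  in-V : Occurs y (s ⟨ x ↦ t ⟩) ⊎ Occurs y (u ⟨ x ↦ t ⟩) → y ∈ V × y ≢ x
  in-V (inj₁ o') with origin s o'
  ... | inj₁ oy , y≢x = h y (inj₁ oy) , y≢x
  ... | inj₂ ot , y≢x = t⊆V y ot , y≢x
  in-V (inj₂ o') with origin u o'
  ... | inj₁ oy , y≢x = h y (inj₂ oy) , y≢x
  ... | inj₂ ot , y≢x = t⊆V y ot , y≢x

swap-result : ∀ {A} s t E → UnifyResult A ((s , t) ∷ E) → UnifyResult A ((t , s) ∷ E)
swap-result s t E (inj₁ (θ , e LAll.∷ U , M , O)) =
  inj₁ (θ , sym e LAll.∷ U , (λ { τ (e' LAll.∷ U') → M τ (sym e' LAll.∷ U') }) , O)
swap-result s t E (inj₂ none) = inj₂ λ { τ (e LAll.∷ U) → none τ (sym e LAll.∷ U) }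

decompose-smaller : ∀ {f m} (ss ts : Vec Term (arity f)) E →
                    sizeEqs ((fun f ss , fun f ts) ∷ E) < suc m → sizeEqs (zipEqs ss ts ++ E) < m
decompose-smaller ss ts E lt = begin-strict
  sizeEqs (zipEqs ss ts ++ E)
    ≡⟨ trans (cong sum (Listₚ.map-++ eqSize (zipEqs ss ts) E)) (sum-++ (map eqSize (zipEqs ss ts)) (map eqSize E)) ⟩
  sizeEqs (zipEqs ss ts) + sizeEqs E
    ≡⟨ cong (_+ sizeEqs E) (zipEqs-size ss ts) ⟩
  sizes ss + sizes ts + sizeEqs E
    <⟨ s≤s (ℕₚ.+-monoˡ-≤ (sizeEqs E) (ℕₚ.+-monoʳ-≤ (sizes ss) (ℕₚ.n≤1+n (sizes ts)))) ⟩
  suc (sizes ss) + suc (sizes ts) + sizeEqs E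
    ≤⟨ ℕₚ.≤-pred lt ⟩
  _ ∎
  where open ℕₚ.≤-Reasoning

-- The unification algorithm on E, whose variables lie in V.  Termination:
-- eliminating a variable shortens V (bounded by n); every other rule
-- decreases the size of E (bounded by m).
mutual
  solve : ∀ {A} (n m : ℕ) (V : List ℕ) (E : List Equation) → length V ≤ n → sizeEqs E < m →
          LAll.All (VarsIn V) E → OverEqs A E → UnifyResult A E
  solve n (suc m) V [] _ _ _ _ = inj₁ (var , LAll.[] , (λ τ _ x → refl) , λ x → var)
  solve n (suc m) V ((var x , var y) ∷ E) lv (s≤s sz) (h LAll.∷ vs) ((_ , oy) LAll.∷ os) with x ℕ.≟ y
  ... | no x≢y = eliminate n V x (var y) E lv (h x (inj₁ here)) (λ { here → x≢y refl }) (λ z o → h z (inj₂ o)) vs oy os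
  ... | yes refl with solve n m V E lv (ℕₚ.≤-trans (ℕₚ.n≤1+n _) sz) vs os
  ...   | inj₁ (θ , U , M , O) = inj₁ (θ , refl LAll.∷ U , (λ { τ (_ LAll.∷ U') → M τ U' }) , O)
  ...   | inj₂ none = inj₂ λ { τ (_ LAll.∷ U) → none τ U }
  solve n (suc m) V ((var x , fun g ts) ∷ E) lv sz (h LAll.∷ vs) ((_ , ot) LAll.∷ os) with occurs? x (fun g ts)
  ... | yes o = inj₂ λ { τ (e LAll.∷ _) → occurs-check τ o e }
  ... | no x∉t = eliminate n V x (fun g ts) E lv (h x (inj₁ here)) x∉t (λ z o → h z (inj₂ o)) vs ot os
  solve n (suc m) V ((fun f ss , var x) ∷ E) lv sz (h LAll.∷ vs) ((os' , _) LAll.∷ os) with occurs? x (fun f ss)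
  ... | yes o = inj₂ λ { τ (e LAll.∷ _) → occurs-check τ o (sym e) }
  ... | no x∉s = swap-result (var x) (fun f ss) E
                   (eliminate n V x (fun f ss) E lv (h x (inj₂ here)) x∉s (λ z o → h z (inj₁ o)) vs os' os)
  solve n (suc m) V ((fun f ss , fun g ts) ∷ E) lv sz (h LAll.∷ vs) ((fun _ oss , fun _ ots) LAll.∷ os)
    with ≡-dec ℕ._≟_ ℕ._≟_ f g
  ... | no f≢g = inj₂ λ { τ (e LAll.∷ _) → f≢g (head-injective e) }
  ... | yes refl
    with solve n m V (zipEqs ss ts ++ E) lv (decompose-smaller {f} ss ts E sz)
           (LAllₚ.++⁺ (zipEqs-vars V ss ts λ { y (inj₁ o) → h y (inj₁ (under o)) ; y (inj₂ o) → h y (inj₂ (under o)) }) vs)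
           (LAllₚ.++⁺ (zipEqs-over oss ots) os)
  ...   | inj₁ (θ , U , M , O) =
          inj₁ (θ , cong (fun f) (Equivalence.to (zipEqs-unifies θ ss ts) (proj₁ (LAllₚ.++⁻ _ U))) LAll.∷ proj₂ (LAllₚ.++⁻ _ U)
               , (λ { τ (e LAll.∷ U') → M τ (LAllₚ.++⁺ (Equivalence.from (zipEqs-unifies τ ss ts) (args-injective e)) U') })
               , O)
  ...   | inj₂ none = inj₂ λ { τ (e LAll.∷ U) → none τ (LAllₚ.++⁺ (Equivalence.from (zipEqs-unifies τ ss ts) (args-injective e)) U) }

  eliminate : ∀ {A} n V x t E → length V ≤ n → x ∈ V → ¬ Occurs x t → (∀ y → Occurs y t → y ∈ V) →
              LAll.All (VarsIn V) E → Over A t → OverEqs A E → UnifyResult A ((var x , t) ∷ E)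
  eliminate zero V x t E lv x∈V x∉t t⊆V vs ot os = ⊥-elim (ℕₚ.n≮0 (ℕₚ.<-≤-trans (remove-shorter x∈V) lv))
  eliminate (suc n) V x t E lv x∈V x∉t t⊆V vs ot os
    with solve n (suc (sizeEqs E')) (remove x V) E' (ℕₚ.≤-pred (ℕₚ.<-≤-trans (remove-shorter x∈V) lv)) ℕₚ.≤-refl
               (LAllₚ.map⁺ (LAll.map (λ {e} → ↦-varsIn V x t x∉t t⊆V e) vs)) (overEqs-subst (x ↦ t) E (↦-over x t ot) os)
    where E' = map (substEq (x ↦ t)) E
  ... | inj₂ none = inj₂ λ { τ (e LAll.∷ U) → none τ (absorbed-unifies (x ↦ t) τ E (↦-absorb x t τ e) U) }
  ... | inj₁ (θ , U , M , O) = inj₁ ((x ↦ t) ⨾ θ , unifies-head LAll.∷ Equivalence.to (unifies-substEqs (x ↦ t) θ E) U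
                                   , most-general , λ y → over-subst _ θ (↦-over x t ot y) O)
    where
    unifies-head : ((x ↦ t) ⨾ θ) x ≡ t ⟨ (x ↦ t) ⨾ θ ⟩
    unifies-head = begin
      (x ↦ t) x ⟨ θ ⟩        ≡⟨ cong (_⟨ θ ⟩) (↦-self x t) ⟩
      t ⟨ θ ⟩                ≡⟨ cong (_⟨ θ ⟩) (sym (↦-fresh x t t x∉t)) ⟩
      t ⟨ x ↦ t ⟩ ⟨ θ ⟩      ≡⟨ subst-comp t (x ↦ t) θ ⟩
      t ⟨ (x ↦ t) ⨾ θ ⟩      ∎
      where open ≡-Reasoning
    most-general : MostGeneral ((x ↦ t) ⨾ θ) ((var x , t) ∷ E)
    most-general τ (e LAll.∷ U') y = begin
      (x ↦ t) y ⟨ θ ⟩ ⟨ τ ⟩  ≡⟨ subst-comp ((x ↦ t) y) θ τ ⟩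
      (x ↦ t) y ⟨ θ ⨾ τ ⟩    ≡⟨ subst-cong ((x ↦ t) y) (M τ (absorbed-unifies (x ↦ t) τ E absorb U')) ⟩
      (x ↦ t) y ⟨ τ ⟩        ≡⟨ absorb y ⟩
      τ y                    ∎
      where
      open ≡-Reasoning
      absorb = ↦-absorb x t τ e

unify : ∀ {A} s t → Over A s → Over A t → UnifyResult A ((s , t) ∷ [])
unify s t os ot =
  solve (length V) (suc (sizeEqs ((s , t) ∷ []))) V ((s , t) ∷ []) ℕₚ.≤-refl ℕₚ.≤-refl
    ((λ { y (inj₁ o) → ∈-++⁺ˡ (vars-complete s o) ; y (inj₂ o) → ∈-++⁺ʳ (vars s) (vars-complete t o) }) LAll.∷ LAll.[])
    ((os , ot) LAll.∷ LAll.[])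
  where V = vars s ++ vars t

∈⇒≤sum : ∀ {x xs} → x ∈ xs → x ≤ sum xs
∈⇒≤sum {xs = y ∷ ys} (here refl) = ℕₚ.m≤m+n y (sum ys)
∈⇒≤sum {xs = y ∷ ys} (there m) = ℕₚ.≤-trans (∈⇒≤sum m) (ℕₚ.m≤n+m (sum ys) y)

-- A bound on the variables of l, used to rename a second rule apart from l.
varBound : Term → ℕ
varBound l = suc (sum (vars l))

varBound-ok : ∀ {x} l → Occurs x l → x < varBound l
varBound-ok l o = s≤s (∈⇒≤sum (vars-complete l o))

shift : ℕ → Subst
shift K x = var (x + K)

-- σ below K and σ₂ on the variables shifted past K: a common instance of a
-- term l with variables below K and of a shifted term.
combine : ℕ → Subst → Subst → Subst
combine K σ σ₂ y with y ℕₚ.<? K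
... | yes _ = σ y
... | no _ = σ₂ (y ∸ K)

combine-low : ∀ K σ σ₂ y → y < K → combine K σ σ₂ y ≡ σ y
combine-low K σ σ₂ y y<K with y ℕₚ.<? K
... | yes _ = refl
... | no y≮K = ⊥-elim (y≮K y<K)

combine-high : ∀ K σ σ₂ x → combine K σ σ₂ (x + K) ≡ σ₂ x
combine-high K σ σ₂ x with (x + K) ℕₚ.<? K
... | yes lt = ⊥-elim (ℕₚ.m+n≮n x K lt)
... | no _ = cong σ₂ (ℕₚ.m+n∸n≡m x K)

update : Subst → ℕ → Term → Subst
update σ x w y with y ℕ.≟ x
... | yes _ = w
... | no _ = σ y

update-self : ∀ σ x w → update σ x w x ≡ w
update-self σ x w with x ℕ.≟ x
... | yes _ = refl
... | no x≢x = ⊥-elim (x≢x refl)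

module CriticalPairs (R : TRS) where
  private
    Rs = rules R
    A = alphabet R

  rule-over : ∀ {l r} → (l , r) ∈ Rs → Over A l × Over A r
  rule-over = LAll.lookup (rulesOver R)

  rule-vars : ∀ {l r} → (l , r) ∈ Rs → ∀ x → Occurs x r → Occurs x l
  rule-vars = LAll.lookup (varCond R)

  overlap-at : ∀ {l₁ r₁ l₂ r₂} → (l₁ , r₁) ∈ Rs → (l₂ , r₂) ∈ Rs → (p : Pos l₁) →
               UnifyResult A ((l₁ ∣ p , l₂ ⟨ shift (varBound l₁) ⟩) ∷ [])
  overlap-at {l₁} {l₂ = l₂} m₁ m₂ p =
    unify (l₁ ∣ p) (l₂ ⟨ shift (varBound l₁) ⟩) (over-subterm l₁ p (proj₁ (rule-over m₁)))
          (over-subst l₂ (shift (varBound l₁)) (proj₁ (rule-over m₂)) (λ _ → var))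

  -- Variable
  -- positions p are included; their pairs are always joinable, so this
  -- does not change the condition and spares a case distinction.
  CriticalPairJoinable : ∀ l₁ r₁ l₂ r₂ (p : Pos l₁) → UnifyResult A ((l₁ ∣ p , l₂ ⟨ shift (varBound l₁) ⟩) ∷ []) → Set
  CriticalPairJoinable l₁ r₁ l₂ r₂ p (inj₁ (θ , _)) =
    Joinable {Rs} (r₁ ⟨ θ ⟩) ((l₁ [ p ← r₂ ⟨ shift (varBound l₁) ⟩ ]) ⟨ θ ⟩)
  CriticalPairJoinable l₁ r₁ l₂ r₂ p (inj₂ _) = ⊤

  CriticalPairsJoinable : Set
  CriticalPairsJoinable = ∀ {l₁ r₁ l₂ r₂} (m₁ : (l₁ , r₁) ∈ Rs) (m₂ : (l₂ , r₂) ∈ Rs) (p : Pos l₁) →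
                          CriticalPairJoinable l₁ r₁ l₂ r₂ p (overlap-at m₁ m₂ p)

  module _ (cps : CriticalPairsJoinable) where

    -- A peak whose second step applies a rule at a position p inside the
    -- first redex l₁ ⟨ σ ⟩ is an instance of the critical pair at p.
    overlap-peak : ∀ {l₁ r₁ l₂ r₂} (m₁ : (l₁ , r₁) ∈ Rs) (m₂ : (l₂ , r₂) ∈ Rs) (p : Pos l₁) σ σ₂ →
                   l₂ ⟨ σ₂ ⟩ ≡ (l₁ ∣ p) ⟨ σ ⟩ → Joinable {Rs} (r₁ ⟨ σ ⟩) (fillⁱ l₁ p σ (r₂ ⟨ σ₂ ⟩))
    overlap-peak {l₁} {r₁} {l₂} {r₂} m₁ m₂ p σ σ₂ redex = instance-of (overlap-at m₁ m₂ p) (cps m₁ m₂ p)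
      where
      K = varBound l₁
      τ = combine K σ σ₂
      τ-on-l₁ : ∀ x → Occurs x l₁ → τ x ≡ σ x
      τ-on-l₁ x o = combine-low K σ σ₂ x (varBound-ok l₁ o)
      τ-on-shifted : ∀ m → m ⟨ shift K ⟩ ⟨ τ ⟩ ≡ m ⟨ σ₂ ⟩
      τ-on-shifted m = trans (subst-comp m (shift K) τ) (subst-cong m (combine-high K σ σ₂))
      τ-unifies : Unifies τ ((l₁ ∣ p , l₂ ⟨ shift K ⟩) ∷ [])
      τ-unifies = trans (subst-ext (l₁ ∣ p) (λ x o → τ-on-l₁ x (occurs-subterm l₁ p o)))
                        (trans (sym redex) (sym (τ-on-shifted l₂))) LAll.∷ LAll.[]
      instance-of : (res : UnifyResult A ((l₁ ∣ p , l₂ ⟨ shift K ⟩) ∷ [])) → CriticalPairJoinable l₁ r₁ l₂ r₂ p res →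
                    Joinable {Rs} (r₁ ⟨ σ ⟩) (fillⁱ l₁ p σ (r₂ ⟨ σ₂ ⟩))
      instance-of (inj₂ none) _ = ⊥-elim (none τ τ-unifies)
      instance-of (inj₁ (θ , _ , mgu , _)) joinable = subst₂ (Joinable {Rs}) left right (join-subst τ joinable)
        where
        θτ : ∀ m → m ⟨ θ ⟩ ⟨ τ ⟩ ≡ m ⟨ τ ⟩
        θτ m = trans (subst-comp m θ τ) (subst-cong m (mgu τ τ-unifies))
        left : r₁ ⟨ θ ⟩ ⟨ τ ⟩ ≡ r₁ ⟨ σ ⟩
        left = trans (θτ r₁) (subst-ext r₁ (λ x o → τ-on-l₁ x (rule-vars m₁ x o)))
        right : (l₁ [ p ← r₂ ⟨ shift K ⟩ ]) ⟨ θ ⟩ ⟨ τ ⟩ ≡ fillⁱ l₁ p σ (r₂ ⟨ σ₂ ⟩)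
        right = begin
          (l₁ [ p ← r₂ ⟨ shift K ⟩ ]) ⟨ θ ⟩ ⟨ τ ⟩  ≡⟨ θτ (l₁ [ p ← r₂ ⟨ shift K ⟩ ]) ⟩
          (l₁ [ p ← r₂ ⟨ shift K ⟩ ]) ⟨ τ ⟩        ≡⟨ replace-subst l₁ p _ τ ⟩
          fillⁱ l₁ p τ (r₂ ⟨ shift K ⟩ ⟨ τ ⟩)       ≡⟨ cong (fillⁱ l₁ p τ) (τ-on-shifted r₂) ⟩
          fillⁱ l₁ p τ (r₂ ⟨ σ₂ ⟩)                  ≡⟨ fillⁱ-ext l₁ p _ τ-on-l₁ ⟩
          fillⁱ l₁ p σ (r₂ ⟨ σ₂ ⟩)                  ∎
          where open ≡-Reasoning

    -- If the second step rewrites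
    -- σ x to w inside a variable of l₁, both sides join at r₁ ⟨ σ' ⟩ with
    -- σ' = σ[x ↦ w], by rewriting every copy of σ x.
    root-peak : ∀ {l₁ r₁} (m₁ : (l₁ , r₁) ∈ Rs) σ {t u} → t ≡ l₁ ⟨ σ ⟩ → Step Rs t u → Joinable {Rs} (r₁ ⟨ σ ⟩) u
    root-peak {l₁} {r₁} m₁ σ e s with step-from-instance l₁ σ e s
    ... | ruleOverlap p σ₂ m₂ redex refl = overlap-peak m₁ m₂ p σ σ₂ redex
    ... | inVariable p x w at-x s' refl =
      r₁ ⟨ σ' ⟩ , steps-substs r₁ σ→σ' ,
      (fillⁱ-steps-subst l₁ p w σ→σ' ◅◅ subst (λ z → Steps Rs z (r₁ ⟨ σ' ⟩)) l₁σ' (root m₁ σ' ◅ ε))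
      where
      σ' = update σ x w
      σ→σ' : ∀ y → Steps Rs (σ y) (σ' y)
      σ→σ' y with y ℕ.≟ x
      ... | yes refl = s' ◅ ε
      ... | no _ = ε
      l₁σ' : l₁ ⟨ σ' ⟩ ≡ fillⁱ l₁ p σ' w
      l₁σ' = begin
        l₁ ⟨ σ' ⟩                          ≡⟨ sym (fillⁱ-subterm l₁ p σ') ⟩
        fillⁱ l₁ p σ' ((l₁ ∣ p) ⟨ σ' ⟩)    ≡⟨ cong (λ z → fillⁱ l₁ p σ' (z ⟨ σ' ⟩)) at-x ⟩
        fillⁱ l₁ p σ' (σ' x)               ≡⟨ cong (fillⁱ l₁ p σ') (update-self σ x w) ⟩
        fillⁱ l₁ p σ' w                    ∎
        where open ≡-Reasoning

    -- Every peak is joinable: by root-peak when one step is at the root,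
    -- by induction when both are in the same argument, and trivially when
    -- they are in different arguments.
    mutual
      peak-joinable : ∀ {t t₁ t₂} → Step Rs t t₁ → Step Rs t t₂ → Joinable {Rs} t₁ t₂
      peak-joinable (root m σ) s₂ = root-peak m σ refl s₂
      peak-joinable (arg i s₁) s₂ = arg-peak i s₁ refl s₂

      arg-peak : ∀ {f ts u t t₂} (i : Fin (arity f)) → Step Rs (lookup ts i) u → t ≡ fun f ts → Step Rs t t₂ →
                 Joinable {Rs} (fun f (ts [ i ]≔ u)) t₂
      arg-peak i s₁ e (root m σ) = join-sym (root-peak m σ (sym e) (arg i s₁))
      arg-peak {f} {ts} {u} i s₁ refl (arg {u = v} j s₂) with i Fin.≟ j
      ... | yes refl with peak-joinable s₁ s₂
      ...   | c , p , q = fun f (ts [ i ]≔ c) , steps-at ts i p , steps-at ts i q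
      arg-peak {f} {ts} {u} i s₁ refl (arg {u = v} j s₂) | no i≢j =
        fun f ((ts [ i ]≔ u) [ j ]≔ v) ,
        (arg j (subst (λ z → Step Rs z v) (sym (lookup∘update′ (λ j≡i → i≢j (sym j≡i)) ts u)) s₂) ◅ ε) ,
        subst (λ z → Steps Rs _ (fun f z)) (sym ([]≔-commutes ts i j i≢j))
          (arg i (subst (λ z → Step Rs z u) (sym (lookup∘update′ i≢j ts v)) s₁) ◅ ε)

  critical-pairs⇒locally-confluent : CriticalPairsJoinable → LocallyConfluent R
  critical-pairs⇒locally-confluent cps _ _ _ _ s₁ s₂ = peak-joinable cps s₁ s₂

  -- Conversely, critical pairs of a locally confluent system are joinable,
  -- being the two reducts of the peak at l₁ ⟨ θ ⟩.
  locally-confluent⇒critical-pairs : LocallyConfluent R → CriticalPairsJoinable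
  locally-confluent⇒critical-pairs lc {l₁} {r₁} {l₂} {r₂} m₁ m₂ p = from-peak (overlap-at m₁ m₂ p)
    where
    K = varBound l₁
    from-peak : (res : UnifyResult A ((l₁ ∣ p , l₂ ⟨ shift K ⟩) ∷ [])) → CriticalPairJoinable l₁ r₁ l₂ r₂ p res
    from-peak (inj₂ _) = tt
    from-peak (inj₁ (θ , (unifies LAll.∷ LAll.[]) , _ , over)) =
      lc (l₁ ⟨ θ ⟩) _ _ (over-subst l₁ θ (proj₁ (rule-over m₁)) over) (root m₁ θ) inner-step
      where
      inner-redex : Step Rs ((l₁ ∣ p) ⟨ θ ⟩) (r₂ ⟨ shift K ⟩ ⟨ θ ⟩)
      inner-redex = subst₂ (Step Rs) (trans (sym (subst-comp l₂ (shift K) θ)) (sym unifies))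
                           (sym (subst-comp r₂ (shift K) θ)) (root m₂ (shift K ⨾ θ))
      inner-step : Step Rs (l₁ ⟨ θ ⟩) ((l₁ [ p ← r₂ ⟨ shift K ⟩ ]) ⟨ θ ⟩)
      inner-step = subst₂ (Step Rs) (fillⁱ-subterm l₁ p θ) (sym (replace-subst l₁ p _ θ))
                          (fillⁱ-step l₁ p θ inner-redex)

-- Derivability in a finite system of Horn clauses over a set with decidable
-- equality is decidable: saturate the set of derived atoms, firing every
-- clause at most once.

module Horn {X : Set} (_≟_ : DecidableEquality X) (clauses : List (List X × X)) where
  open import Data.List.Membership.DecPropositional _≟_ using (_∈?_)

  Clause : Set
  Clause = List X × X

  data Derivable : X → Set where
    derive : ∀ {ps c} → (ps , c) ∈ clauses → (∀ {p} → p ∈ ps → Derivable p) → Derivable c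

  Fires : List X → Clause → Set
  Fires S c = LAll.All (_∈ S) (proj₁ c)

  Closed : List X → Set
  Closed S = ∀ {ps c} → (ps , c) ∈ clauses → Fires S (ps , c) → c ∈ S

  data Pick (S : List X) (rem : List Clause) : Set where
    fires : ∀ c rest → rem ↭ c ∷ rest → Fires S c → Pick S rem
    stuck : LAll.All (λ c → ¬ Fires S c) rem → Pick S rem

  pick : ∀ S rem → Pick S rem
  pick S [] = stuck LAll.[]
  pick S (c ∷ rem) with LAll.all? (_∈? S) (proj₁ c)
  ... | yes f = fires c rem Perm.refl f
  ... | no ¬f with pick S rem
  ...   | fires c' rest π f = fires c' (c ∷ rest) (Perm.trans (Perm.prep c π) (Perm.swap c c' Perm.refl)) f
  ...   | stuck none = stuck (¬f LAll.∷ none)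

  -- Invariant: the atoms of S are derivable, the clauses rem
  -- not yet fired are clauses, and every other clause has its head in S.
  -- Firing a clause removes it from rem, so n = length rem bounds the work.
  saturate : ∀ n S rem → length rem ≡ n → (∀ {x} → x ∈ S → Derivable x) →
             (∀ {c} → c ∈ rem → c ∈ clauses) → (∀ {ps c} → (ps , c) ∈ clauses → (ps , c) ∈ rem ⊎ c ∈ S) →
             Σ (List X) λ S' → (∀ {x} → x ∈ S' → Derivable x) × Closed S'
  saturate n S rem len sound rem⊆ covered with pick S rem
  ... | stuck none = S , sound , closed
    where
    closed : Closed S
    closed m f with covered m
    ... | inj₁ m' = ⊥-elim (LAll.lookup none m' f)
    ... | inj₂ c∈S = c∈S
  saturate zero S rem len sound rem⊆ covered | fires c rest π f
    with () ← trans (sym (↭-length π)) len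
  saturate (suc n) S rem len sound rem⊆ covered | fires (ps , x) rest π f =
    saturate n (x ∷ S) rest (ℕₚ.suc-injective (trans (sym (↭-length π)) len)) sound' rest⊆ covered'
    where
    sound' : ∀ {y} → y ∈ x ∷ S → Derivable y
    sound' (here refl) = derive (rem⊆ (∈-resp-↭ (↭-sym π) (here refl))) (λ m → sound (LAll.lookup f m))
    sound' (there m) = sound m
    rest⊆ : ∀ {c} → c ∈ rest → c ∈ clauses
    rest⊆ m = rem⊆ (∈-resp-↭ (↭-sym π) (there m))
    covered' : ∀ {ps' c'} → (ps' , c') ∈ clauses → (ps' , c') ∈ rest ⊎ c' ∈ x ∷ S
    covered' m with covered m
    ... | inj₂ c'∈S = inj₂ (there c'∈S)
    ... | inj₁ m' with ∈-resp-↭ π m'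
    ...   | here refl = inj₂ (here refl)
    ...   | there m'' = inj₁ m''

  derivable? : ∀ x → Dec (Derivable x)
  derivable? x with saturate (length clauses) [] clauses refl (λ ()) (λ m → m) inj₁
  ... | S , sound , closed with x ∈? S
  ...   | yes x∈S = yes (sound x∈S)
  ...   | no x∉S = no (λ d → x∉S (derivable⇒∈ d))
    where
    derivable⇒∈ : ∀ {y} → Derivable y → y ∈ S
    derivable⇒∈ (derive m h) = closed m (LAll.tabulate (λ p∈ps → derivable⇒∈ (h p∈ps)))

-- Runs are stable under
-- backward rewriting by the automaton rules, so every accepted term has an
-- accepting run.

module Runs {A : Alphabet} (C : BTA A) where
  open BTA C

  ruleSet : List Rule
  ruleSet = map bruleTerms brules

  EpsMoves : ℕ → ℕ → Set
  EpsMoves = Star (λ a a' → eps a a' ∈ brules)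

  data Run : Term → ℕ → Set where
    at-state : ∀ {t a q} → t ≡ stateTerm a → a ∈ states → EpsMoves a q → Run t q
    by-move  : ∀ {t δ} {ts : Vec Term (arity δ)} {as a q} → t ≡ fun δ ts → move δ as a ∈ brules →
               (∀ i → Run (lookup ts i) (lookup as i)) → EpsMoves a q → Run t q

  well-formed : ∀ {b} → b ∈ brules → WFBRule A states b
  well-formed = LAll.lookup brulesOK

  state-fresh : ∀ {a} → a ∈ states → (a , 0) ∉ A
  state-fresh = LAll.lookup fresh

  state-not-move : ∀ {a δ} {ts : Vec Term (arity δ)} {as b} → a ∈ states → stateTerm a ≡ fun δ ts →
                   move δ as b ∈ brules → ⊥
  state-not-move a∈Q e m = state-fresh a∈Q (subst (_∈ A) (sym (head-injective e)) (proj₁ (well-formed m)))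

  eps-target : ∀ {a q} → a ∈ states → EpsMoves a q → q ∈ states
  eps-target a∈Q ε = a∈Q
  eps-target a∈Q (m ◅ es) = eps-target (proj₂ (well-formed m)) es

  lookup-states : ∀ {n} (as : Vec ℕ n) σ i → lookup (substs (Vec.map stateTerm as) σ) i ≡ stateTerm (lookup as i)
  lookup-states (a ∷ as) σ zero = refl
  lookup-states (a ∷ as) σ (suc i) = lookup-states as σ i

  back-root : ∀ {b q} σ → b ∈ brules → Run (proj₂ (bruleTerms b) ⟨ σ ⟩) q → Run (proj₁ (bruleTerms b) ⟨ σ ⟩) q
  back-root {move δ as a} σ m (at-state refl _ es) =
    by-move refl m (λ i → at-state (lookup-states as σ i) (VAllₚ.lookup⁺ (proj₁ (proj₂ (well-formed m))) i) ε) es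
  back-root {move δ as a} σ m (by-move e m' _ _) = ⊥-elim (state-not-move (proj₂ (proj₂ (well-formed m))) e m')
  back-root {eps a a'} σ m (at-state refl _ es) = at-state refl (proj₁ (well-formed m)) (m ◅ es)
  back-root {eps a a'} σ m (by-move e m' _ _) = ⊥-elim (state-not-move (proj₂ (well-formed m)) e m')

  back : ∀ {t t' q} → Step ruleSet t t' → Run t' q → Run t q
  back (root mem σ) run with ∈-map⁻ bruleTerms mem
  ... | b , m , refl = back-root σ m run
  back (arg i s) (at-state e _ _) = ⊥-elim (no-argument (head-injective e) i)
    where
    no-argument : ∀ {f a} → f ≡ (a , 0) → Fin (arity f) → ⊥
    no-argument refl ()
  back (arg {f} {ts} {u} i s) (by-move refl m h es) = by-move refl m h' es
    where
    h' : ∀ j → Run (lookup ts j) _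
    h' j with i Fin.≟ j
    ... | yes refl = back s (subst (λ z → Run z _) (lookup∘update i ts u) (h i))
    ... | no i≢j = subst (λ z → Run z _) (lookup∘update′ (λ j≡i → i≢j (sym j≡i)) ts u) (h j)

  back* : ∀ {t t' q} → Steps ruleSet t t' → Run t' q → Run t q
  back* ε run = run
  back* (s ◅ ss) run = back s (back* ss run)

  accepting-run : ∀ {t} → (∃ λ q → q ∈ final × Steps ruleSet t (stateTerm q)) → ∃ λ q → q ∈ final × Run t q
  accepting-run (q , q∈F , ss) = q , q∈F , back* ss (at-state refl (LAll.lookup finalOK q∈F) ε)

  move-step : ∀ {δ as a} → move δ as a ∈ brules → Step ruleSet (fun δ (Vec.map stateTerm as)) (stateTerm a)
  move-step {δ} {as} {a} m =
    subst (λ z → Step ruleSet z (stateTerm a)) (subst-id (fun δ (Vec.map stateTerm as))) (root (∈-map⁺ bruleTerms m) var)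

  eps-step : ∀ {a a'} → eps a a' ∈ brules → Step ruleSet (stateTerm a) (stateTerm a')
  eps-step m = root (∈-map⁺ bruleTerms m) var

pairs : ∀ {n} → Vec ℕ n → Vec ℕ n → List (ℕ × ℕ)
pairs [] [] = []
pairs (a ∷ as) (b ∷ bs) = (a , b) ∷ pairs as bs

pairs-∈⁺ : ∀ {n} (as bs : Vec ℕ n) i → (lookup as i , lookup bs i) ∈ pairs as bs
pairs-∈⁺ (a ∷ as) (b ∷ bs) zero = here refl
pairs-∈⁺ (a ∷ as) (b ∷ bs) (suc i) = there (pairs-∈⁺ as bs i)

pairs-∈⁻ : ∀ {n} (as bs : Vec ℕ n) {p} → p ∈ pairs as bs → ∃ λ i → p ≡ (lookup as i , lookup bs i)
pairs-∈⁻ [] [] ()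
pairs-∈⁻ (a ∷ as) (b ∷ bs) (here e) = zero , e
pairs-∈⁻ (a ∷ as) (b ∷ bs) (there m) with pairs-∈⁻ as bs m
... | i , e = suc i , e

∈-concatMap : ∀ {X Y : Set} (g : X → List Y) {x y xs} → x ∈ xs → y ∈ g x → y ∈ concatMap g xs
∈-concatMap g x∈xs y∈gx = ∈-concatMap⁺ g (lose x∈xs y∈gx)

all-concatMap : ∀ {X Y : Set} {P : Y → Set} (g : X → List Y) xs →
                (∀ {x} → x ∈ xs → LAll.All P (g x)) → LAll.All P (concatMap g xs)
all-concatMap g xs h = LAllₚ.concat⁺ (LAllₚ.map⁺ (LAll.tabulate h))

-- A pair of
-- states (q₁ , q₂) is reachable by a common ground term iff it is derivable
-- in the Horn clause system simulating both automata in lockstep.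

module Intersection {A : Alphabet} (C₁ C₂ : BTA A) where
  module R₁ = Runs C₁
  module R₂ = Runs C₂
  open BTA

  PairClause : Set
  PairClause = List (ℕ × ℕ) × (ℕ × ℕ)

  moveClauses : BRule → BRule → List PairClause
  moveClauses (move δ₁ as₁ a₁) (move δ₂ as₂ a₂) with ≡-dec ℕ._≟_ ℕ._≟_ δ₁ δ₂
  ... | yes refl = (pairs as₁ as₂ , (a₁ , a₂)) ∷ []
  ... | no _ = []
  moveClauses _ _ = []

  epsClauses₁ : BRule → ℕ → List PairClause
  epsClauses₁ (eps a a') q = (((a , q) ∷ []) , (a' , q)) ∷ []
  epsClauses₁ _ q = []

  epsClauses₂ : BRule → ℕ → List PairClause
  epsClauses₂ (eps a a') q = (((q , a) ∷ []) , (q , a')) ∷ []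
  epsClauses₂ _ q = []

  moveFamily eps₁Family eps₂Family clauses : List PairClause
  moveFamily = concatMap (λ b₁ → concatMap (moveClauses b₁) (brules C₂)) (brules C₁)
  eps₁Family = concatMap (λ b → concatMap (epsClauses₁ b) (states C₂)) (brules C₁)
  eps₂Family = concatMap (λ b → concatMap (epsClauses₂ b) (states C₁)) (brules C₂)
  clauses = moveFamily ++ eps₁Family ++ eps₂Family

  move-clause : ∀ {δ} {as₁ as₂ : Vec ℕ (arity δ)} {a₁ a₂} → move δ as₁ a₁ ∈ brules C₁ → move δ as₂ a₂ ∈ brules C₂ →
                (pairs as₁ as₂ , (a₁ , a₂)) ∈ clauses
  move-clause {δ} m₁ m₂ = ∈-++⁺ˡ (∈-concatMap (λ b₁ → concatMap (moveClauses b₁) (brules C₂)) m₁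
                                   (∈-concatMap (moveClauses _) m₂ same-symbol))
    where
    same-symbol : ∀ {as₁ as₂ : Vec ℕ (arity δ)} {a₁ a₂} →
                  (pairs as₁ as₂ , (a₁ , a₂)) ∈ moveClauses (move δ as₁ a₁) (move δ as₂ a₂)
    same-symbol with ≡-dec ℕ._≟_ ℕ._≟_ δ δ
    ... | yes refl = here refl
    ... | no δ≢δ = ⊥-elim (δ≢δ refl)

  eps₁-clause : ∀ {a a' q} → eps a a' ∈ brules C₁ → q ∈ states C₂ → (((a , q) ∷ []) , (a' , q)) ∈ clauses
  eps₁-clause m q∈Q = ∈-++⁺ʳ moveFamily (∈-++⁺ˡ (∈-concatMap (λ b → concatMap (epsClauses₁ b) (states C₂)) m
                                                  (∈-concatMap (epsClauses₁ _) q∈Q (here refl))))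

  eps₂-clause : ∀ {a a' q} → eps a a' ∈ brules C₂ → q ∈ states C₁ → (((q , a) ∷ []) , (q , a')) ∈ clauses
  eps₂-clause m q∈Q = ∈-++⁺ʳ moveFamily (∈-++⁺ʳ eps₁Family (∈-concatMap (λ b → concatMap (epsClauses₂ b) (states C₁)) m
                                                             (∈-concatMap (epsClauses₂ _) q∈Q (here refl))))

  open Horn (≡-dec ℕ._≟_ ℕ._≟_) clauses

  -- The intended meaning of an atom (q₁ , q₂).
  CommonTerm : ℕ × ℕ → Set
  CommonTerm (q₁ , q₂) =
    ∃ λ w → Ground A w × Steps R₁.ruleSet w (stateTerm q₁) × Steps R₂.ruleSet w (stateTerm q₂)

  Valid : PairClause → Set
  Valid (ps , c) = (∀ {p} → p ∈ ps → CommonTerm p) → CommonTerm c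

  moveClauses-valid : ∀ {b₁ b₂} → b₁ ∈ brules C₁ → b₂ ∈ brules C₂ → LAll.All Valid (moveClauses b₁ b₂)
  moveClauses-valid {move δ₁ as₁ a₁} {move δ₂ as₂ a₂} m₁ m₂ with ≡-dec ℕ._≟_ ℕ._≟_ δ₁ δ₂
  ... | no _ = LAll.[]
  ... | yes refl = common LAll.∷ LAll.[]
    where
    common : Valid (pairs as₁ as₂ , (a₁ , a₂))
    common h = fun δ₁ ws , fun (proj₁ (R₁.well-formed m₁)) (VAllₚ.lookup⁻ ground)
             , steps-fun (args R₁.ruleSet as₁ (λ i → proj₁ (proj₂ (proj₂ (W i))))) ◅◅ (R₁.move-step m₁ ◅ ε)
             , steps-fun (args R₂.ruleSet as₂ (λ i → proj₂ (proj₂ (proj₂ (W i))))) ◅◅ (R₂.move-step m₂ ◅ ε)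
      where
      W : ∀ i → CommonTerm (lookup as₁ i , lookup as₂ i)
      W i = h (pairs-∈⁺ as₁ as₂ i)
      ws = Vec.tabulate (λ i → proj₁ (W i))
      ground : ∀ i → Ground A (lookup ws i)
      ground i rewrite lookup∘tabulate (λ i → proj₁ (W i)) i = proj₁ (proj₂ (W i))
      args : ∀ Rs (as : Vec ℕ (arity δ₁)) → (∀ i → Steps Rs (proj₁ (W i)) (stateTerm (lookup as i))) →
             Pointwise (Steps Rs) ws (Vec.map stateTerm as)
      args Rs as h' = Pointwiseₑ.extensional⇒inductive (Pointwiseₑ.ext λ i →
        subst₂ (Steps Rs) (sym (lookup∘tabulate (λ i → proj₁ (W i)) i)) (sym (lookup-map i stateTerm as)) (h' i))
  moveClauses-valid {move _ _ _} {eps _ _} m₁ m₂ = LAll.[]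
  moveClauses-valid {eps _ _} {move _ _ _} m₁ m₂ = LAll.[]
  moveClauses-valid {eps _ _} {eps _ _} m₁ m₂ = LAll.[]

  epsClauses₁-valid : ∀ {b} q → b ∈ brules C₁ → LAll.All Valid (epsClauses₁ b q)
  epsClauses₁-valid {eps a a'} q m =
    (λ h → let (w , g , s₁ , s₂) = h (here refl) in w , g , s₁ ◅◅ (R₁.eps-step m ◅ ε) , s₂) LAll.∷ LAll.[]
  epsClauses₁-valid {move _ _ _} q m = LAll.[]

  epsClauses₂-valid : ∀ {b} q → b ∈ brules C₂ → LAll.All Valid (epsClauses₂ b q)
  epsClauses₂-valid {eps a a'} q m =
    (λ h → let (w , g , s₁ , s₂) = h (here refl) in w , g , s₁ , s₂ ◅◅ (R₂.eps-step m ◅ ε)) LAll.∷ LAll.[]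
  epsClauses₂-valid {move _ _ _} q m = LAll.[]

  clauses-valid : LAll.All Valid clauses
  clauses-valid =
    LAllₚ.++⁺ (all-concatMap _ (brules C₁) λ m₁ → all-concatMap _ (brules C₂) λ m₂ → moveClauses-valid m₁ m₂)
   (LAllₚ.++⁺ (all-concatMap _ (brules C₁) λ m → all-concatMap _ (states C₂) λ {q} _ → epsClauses₁-valid q m)
              (all-concatMap _ (brules C₂) λ m → all-concatMap _ (states C₁) λ {q} _ → epsClauses₂-valid q m))

  sound : ∀ {x} → Derivable x → CommonTerm x
  sound (derive m h) = LAll.lookup clauses-valid m (λ p∈ps → sound (h p∈ps))

  derive-move : ∀ {δ} {as₁ as₂ : Vec ℕ (arity δ)} {a₁ a₂} → move δ as₁ a₁ ∈ brules C₁ → move δ as₂ a₂ ∈ brules C₂ →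
                (∀ i → Derivable (lookup as₁ i , lookup as₂ i)) → Derivable (a₁ , a₂)
  derive-move {δ} {as₁} {as₂} m₁ m₂ h = derive (move-clause m₁ m₂) premises
    where
    premises : ∀ {p} → p ∈ pairs as₁ as₂ → Derivable p
    premises m with pairs-∈⁻ as₁ as₂ m
    ... | i , refl = h i

  derive-eps₁ : ∀ {a q b} → b ∈ states C₂ → R₁.EpsMoves a q → Derivable (a , b) → Derivable (q , b)
  derive-eps₁ b∈Q ε d = d
  derive-eps₁ b∈Q (m ◅ es) d = derive-eps₁ b∈Q es (derive (eps₁-clause m b∈Q) λ { (here refl) → d })

  derive-eps₂ : ∀ {a q b} → b ∈ states C₁ → R₂.EpsMoves a q → Derivable (b , a) → Derivable (b , q)
  derive-eps₂ b∈Q ε d = d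
  derive-eps₂ b∈Q (m ◅ es) d = derive-eps₂ b∈Q es (derive (eps₂-clause m b∈Q) λ { (here refl) → d })

  complete : ∀ {w q₁ q₂} → Ground A w → R₁.Run w q₁ → R₂.Run w q₂ → Derivable (q₁ , q₂)
  complete (fun f∈A _) (R₁.at-state e a∈Q _) _ = ⊥-elim (R₁.state-fresh a∈Q (subst (_∈ A) (head-injective e) f∈A))
  complete (fun f∈A _) (R₁.by-move _ _ _ _) (R₂.at-state e a∈Q _) =
    ⊥-elim (R₂.state-fresh a∈Q (subst (_∈ A) (head-injective e) f∈A))
  complete (fun _ gs) (R₁.by-move refl m₁ h₁ e₁) (R₂.by-move refl m₂ h₂ e₂) =
    derive-eps₂ (R₁.eps-target (proj₂ (proj₂ (R₁.well-formed m₁))) e₁) e₂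
      (derive-eps₁ (proj₂ (proj₂ (R₂.well-formed m₂))) e₁
        (derive-move m₁ m₂ (λ i → complete (VAllₚ.lookup⁺ gs i) (h₁ i) (h₂ i))))

  NonEmpty : Set
  NonEmpty = ∃ λ w → Accepts C₁ w × Accepts C₂ w

  nonEmpty? : Dec NonEmpty
  nonEmpty? with Any.any? (λ q₁ → Any.any? (λ q₂ → derivable? (q₁ , q₂)) (final C₂)) (final C₁)
  ... | yes found with find found
  ...   | q₁ , q₁∈F , found₂ with find found₂
  ...     | q₂ , q₂∈F , d with sound d
  ...       | w , g , s₁ , s₂ = yes (w , (g , q₁ , q₁∈F , s₁) , (g , q₂ , q₂∈F , s₂))
  nonEmpty? | no none = no λ { (w , (g , acc₁) , (_ , acc₂)) →
    let (q₁ , q₁∈F , run₁) = R₁.accepting-run acc₁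
        (q₂ , q₂∈F , run₂) = R₂.accepting-run acc₂
    in none (lose q₁∈F (lose q₂∈F (complete g run₁ run₂))) }

-- Freezing: variables become constants outside the alphabet A, so that
-- rewriting of open terms over A is reflected by rewriting of ground terms.

module Freeze (A : Alphabet) where

  M : ℕ
  M = suc (sum (map proj₁ A))

  name<M : ∀ {f} → f ∈ A → proj₁ f < M
  name<M m = s≤s (∈⇒≤sum (∈-map⁺ proj₁ m))

  frozen : ℕ → Sym
  frozen x = M + x , 0

  freeze : Subst
  freeze x = fun (frozen x) []

  mutual
    thaw : Term → Term
    thaw (var x) = var x
    thaw (fun (n , zero) []) with M ℕₚ.≤? n
    ... | yes _ = var (n ∸ M)
    ... | no _ = fun (n , zero) []
    thaw (fun (n , suc k) ts) = fun (n , suc k) (thawᵛ ts)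

    thawᵛ : ∀ {k} → Vec Term k → Vec Term k
    thawᵛ [] = []
    thawᵛ (t ∷ ts) = thaw t ∷ thawᵛ ts

  thaw-freeze : ∀ x → thaw (freeze x) ≡ var x
  thaw-freeze x with M ℕₚ.≤? (M + x)
  ... | yes _ = cong var (ℕₚ.m+n∸m≡n M x)
  ... | no M≰M+x = ⊥-elim (M≰M+x (ℕₚ.m≤m+n M x))

  mutual
    thaw-subst : ∀ l σ → Over A l → thaw (l ⟨ σ ⟩) ≡ l ⟨ thaw ∘ σ ⟩
    thaw-subst (var x) σ o = refl
    thaw-subst (fun (n , zero) []) σ (fun m VAll.[]) with M ℕₚ.≤? n
    ... | yes M≤n = ⊥-elim (ℕₚ.<-irrefl refl (ℕₚ.<-≤-trans (name<M m) M≤n))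
    ... | no _ = refl
    thaw-subst (fun (n , suc k) ts) σ (fun m os) = cong (fun (n , suc k)) (thawᵛ-subst ts σ os)

    thawᵛ-subst : ∀ {k} (ts : Vec Term k) σ → VAll.All (Over A) ts → thawᵛ (substs ts σ) ≡ substs ts (thaw ∘ σ)
    thawᵛ-subst [] σ VAll.[] = refl
    thawᵛ-subst (t ∷ ts) σ (o VAll.∷ os) = cong₂ _∷_ (thaw-subst t σ o) (thawᵛ-subst ts σ os)

  thaw-frozen : ∀ s → Over A s → thaw (s ⟨ freeze ⟩) ≡ s
  thaw-frozen s o = begin
    thaw (s ⟨ freeze ⟩)     ≡⟨ thaw-subst s freeze o ⟩
    s ⟨ thaw ∘ freeze ⟩     ≡⟨ subst-cong s thaw-freeze ⟩
    s ⟨ var ⟩               ≡⟨ subst-id s ⟩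
    s                       ∎
    where open ≡-Reasoning

  lookup-thawᵛ : ∀ {k} (ts : Vec Term k) i → lookup (thawᵛ ts) i ≡ thaw (lookup ts i)
  lookup-thawᵛ (t ∷ ts) zero = refl
  lookup-thawᵛ (t ∷ ts) (suc i) = lookup-thawᵛ ts i

  thawᵛ-update : ∀ {k} (ts : Vec Term k) i u → thawᵛ (ts [ i ]≔ u) ≡ thawᵛ ts [ i ]≔ thaw u
  thawᵛ-update (t ∷ ts) zero u = refl
  thawᵛ-update (t ∷ ts) (suc i) u = cong (_ ∷_) (thawᵛ-update ts i u)

  module _ (Rs : List Rule) (rules-over : LAll.All (λ lr → Over A (proj₁ lr) × Over A (proj₂ lr)) Rs) where

    thaw-step : ∀ {a b} → Step Rs a b → Step Rs (thaw a) (thaw b)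
    thaw-step (root {l} {r} m σ) =
      subst₂ (Step Rs) (sym (thaw-subst l σ (proj₁ (LAll.lookup rules-over m))))
                       (sym (thaw-subst r σ (proj₂ (LAll.lookup rules-over m))))
        (root m (thaw ∘ σ))
    thaw-step (arg {n , zero} () s)
    thaw-step (arg {n , suc k} {ts} {u} i s) rewrite thawᵛ-update ts i u =
      arg i (subst (λ z → Step Rs z (thaw u)) (sym (lookup-thawᵛ ts i)) (thaw-step s))

    thaw-steps : ∀ {a b} → Steps Rs a b → Steps Rs (thaw a) (thaw b)
    thaw-steps = gmap thaw thaw-step

module Joinability (R : TRS) (eprf : EPRF R) where
  private
    A = alphabet R
    Rs = rules R
  open Freeze A

  module _ (s t : Term) (os : Over A s) (ot : Over A t) where

    A' : Alphabet
    A' = A ++ map frozen (vars s ++ vars t)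

    mutual
      frozen-ground : ∀ m → Over A m → (∀ x → Occurs x m → x ∈ vars s ++ vars t) → Ground A' (m ⟨ freeze ⟩)
      frozen-ground (var x) var h = fun (∈-++⁺ʳ A (∈-map⁺ frozen (h x here))) VAll.[]
      frozen-ground (fun f ms) (fun f∈A os) h = fun (∈-++⁺ˡ f∈A) (frozen-groundᵛ ms os (λ x o → h x (under o)))

      frozen-groundᵛ : ∀ {k} (ms : Vec Term k) → VAll.All (Over A) ms →
                       (∀ x → VAny.Any (Occurs x) ms → x ∈ vars s ++ vars t) → VAll.All (Ground A') (substs ms freeze)
      frozen-groundᵛ [] VAll.[] h = VAll.[]
      frozen-groundᵛ (m ∷ ms) (o VAll.∷ os) h =
        frozen-ground m o (λ x o' → h x (VAny.here o')) VAll.∷ frozen-groundᵛ ms os (λ x o' → h x (VAny.there o'))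

    sign : SignIn R A'
    sign = LAll.map (λ { (l , r) → over-mono ∈-++⁺ˡ l , over-mono ∈-++⁺ˡ r }) (rulesOver R)

    descendants₁ = eprf A' sign (s ⟨ freeze ⟩ ∷ [])
                        (frozen-ground s os (λ x o → ∈-++⁺ˡ (vars-complete s o)) LAll.∷ LAll.[])
    descendants₂ = eprf A' sign (t ⟨ freeze ⟩ ∷ [])
                        (frozen-ground t ot (λ x o → ∈-++⁺ʳ (vars s) (vars-complete t o)) LAll.∷ LAll.[])
    open Intersection (proj₁ descendants₁) (proj₁ descendants₂) using (NonEmpty; nonEmpty?)

    common⇒joinable : NonEmpty → Joinable {Rs} s t
    common⇒joinable (w , acc₁ , acc₂)
      with Equivalence.to (proj₂ descendants₁ w) acc₁ | Equivalence.to (proj₂ descendants₂ w) acc₂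
    ... | _ , here refl , p | _ , here refl , q =
      thaw w , subst (λ z → Steps Rs z (thaw w)) (thaw-frozen s os) (thaw-steps Rs (rulesOver R) p)
             , subst (λ z → Steps Rs z (thaw w)) (thaw-frozen t ot) (thaw-steps Rs (rulesOver R) q)

    joinable⇒common : Joinable {Rs} s t → NonEmpty
    joinable⇒common (c , p , q) = c ⟨ freeze ⟩
      , Equivalence.from (proj₂ descendants₁ (c ⟨ freeze ⟩)) (s ⟨ freeze ⟩ , here refl , steps-subst freeze p)
      , Equivalence.from (proj₂ descendants₂ (c ⟨ freeze ⟩)) (t ⟨ freeze ⟩ , here refl , steps-subst freeze q)

    joinable? : Dec (Joinable {Rs} s t)
    joinable? = Dec.map′ common⇒joinable joinable⇒common nonEmpty?

all-members? : ∀ {X : Set} (xs : List X) {P : ∀ {x} → x ∈ xs → Set} →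
               (∀ {x} (m : x ∈ xs) → Dec (P m)) → Dec (∀ {x} (m : x ∈ xs) → P m)
all-members? [] P? = yes (λ ())
all-members? (x ∷ xs) {P} P? with P? (here refl) | all-members? xs {λ m → P (there m)} (λ m → P? (there m))
... | yes p | yes ps = yes (λ { (here refl) → p ; (there m) → ps m })
... | yes _ | no ¬ps = no (λ all → ¬ps (λ m → all (there m)))
... | no ¬p | _ = no (λ all → ¬p (all (here refl)))

module DecideCriticalPairs (R : TRS) (eprf : EPRF R) where
  open CriticalPairs R
  open Joinability R eprf using (joinable?)

  critical-pair? : ∀ {l₁ r₁ l₂ r₂} (m₁ : (l₁ , r₁) ∈ rules R) (m₂ : (l₂ , r₂) ∈ rules R) (p : Pos l₁) →
                   Dec (CriticalPairJoinable l₁ r₁ l₂ r₂ p (overlap-at m₁ m₂ p))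
  critical-pair? {l₁} {r₁} {l₂} {r₂} m₁ m₂ p = decide (overlap-at m₁ m₂ p)
    where
    decide : (res : UnifyResult (alphabet R) ((l₁ ∣ p , l₂ ⟨ shift (varBound l₁) ⟩) ∷ [])) →
             Dec (CriticalPairJoinable l₁ r₁ l₂ r₂ p res)
    decide (inj₂ _) = yes tt
    decide (inj₁ (θ , _ , _ , over)) =
      joinable? _ _ (over-subst r₁ θ (proj₂ (rule-over m₁)) over)
                    (over-subst _ θ (over-replace l₁ p _ (proj₁ (rule-over m₁))
                                       (over-subst r₂ _ (proj₂ (rule-over m₂)) (λ _ → var))) over)

  -- The critical pair condition restated by quantifying over members of the
  -- rule list, then over positions, so each quantifier ranges over a finite list.
  AllOverlapsWith : ∀ {ρ₁} → ρ₁ ∈ rules R → Set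
  AllOverlapsWith {l₁ , r₁} m₁ = ∀ {ρ₂} (m₂ : ρ₂ ∈ rules R) (p : Pos l₁) →
    CriticalPairJoinable l₁ r₁ (proj₁ ρ₂) (proj₂ ρ₂) p (overlap-at m₁ m₂ p)

  all-overlaps? : Dec (∀ {ρ₁} (m₁ : ρ₁ ∈ rules R) → AllOverlapsWith m₁)
  all-overlaps? = all-members? (rules R) λ m₁ → all-members? (rules R) λ m₂ → all-positions? _ (critical-pair? m₁ m₂)

  critical-pairs? : Dec CriticalPairsJoinable
  critical-pairs? = Dec.map′ to from all-overlaps?
    where
    to : (∀ {ρ₁} (m₁ : ρ₁ ∈ rules R) → AllOverlapsWith m₁) → CriticalPairsJoinable
    to h {l₁} {r₁} {l₂} {r₂} m₁ m₂ p = h {l₁ , r₁} m₁ {l₂ , r₂} m₂ p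
    from : CriticalPairsJoinable → ∀ {ρ₁} (m₁ : ρ₁ ∈ rules R) → AllOverlapsWith m₁
    from h m₁ m₂ p = h m₁ m₂ p

mainTheorem4 : (R : TRS) → EPRF R → Dec (LocallyConfluent R)
mainTheorem4 R eprf =
  Dec.map′ critical-pairs⇒locally-confluent locally-confluent⇒critical-pairs critical-pairs?
  where
  open CriticalPairs R
  open DecideCriticalPairs R eprf
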